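{- Let $k \ge 2$ be an integer. Suppose that $G$ is an $n$-vertex graph containing no cycle of length $3,5,\ldots,2k+1$ (i.e., no odd cycle of length at most $2k+1$) as a subgraph, and satisfying $$\delta(G) > \min\left\{ \frac{n}{k+1} - \frac{\Delta(G)}{2k+2},~ \frac{n-1-\Delta(G)}{k} \right\}.$$ Then $G$ is bipartite.
   Context: All graphs are finite and simple. $\delta(G)$ and $\Delta(G)$ denote the minimum and maximum degree of $G$. -}

module Defs where

open import Data.Nat using (ℕ; zero; suc; _+_; _*_; _⊓_; _⊔_)
open import Data.Bool using (Bool; true; false; if_then_else_)
open import Data.Fin using (Fin; zero; suc; inject₁; fromℕ)
open import Data.List using (List; foldr; map)
open import Data.Nat.ListAction using (sum)
open import Data.List using () renaming (allFin to allFinL)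
open import Data.Product using (Σ; _×_; _,_)
open import Function.Definitions using (Injective)
open import Relation.Binary.PropositionalEquality using (_≡_; _≢_)
open import Relation.Nullary using (¬_)
open import Data.Empty using (⊥)
open import Data.Integer using (ℤ; +_; _-_)
open import Data.Rational as ℚ using (ℚ; _/_)

record Graph (n : ℕ) : Set where
  field
    adj    : Fin n → Fin n → Bool
    sym    : ∀ u v → adj u v ≡ adj v u
    irrefl : ∀ v → adj v v ≡ false
open Graph public

Adj : ∀ {n} → Graph n → Fin n → Fin n → Set
Adj G u v = adj G u v ≡ true

deg : ∀ {n} → Graph n → Fin n → ℕ
deg {n} G v = sum (map (λ w → if adj G v w then 1 else 0) (allFinL n))

maxDeg : ∀ {n} → Graph n → ℕ
maxDeg {n} G = foldr _⊔_ 0 (map (deg G) (allFinL n))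

-- minimum degree (convention: 0 for the empty graph)
minDeg : ∀ {n} → Graph n → ℕ
minDeg {zero}  G = 0
minDeg {suc m} G = foldr _⊓_ (deg G zero) (map (deg G) (allFinL (suc m)))

-- G contains a cycle of length (suc m) as a subgraph: distinct vertices
-- c 0, …, c m with c i ~ c (i+1) and c m ~ c 0.  (Used with suc m ≥ 3.)
ContainsCycle : ∀ {n} → Graph n → ℕ → Set
ContainsCycle {n} G zero = ⊥
ContainsCycle {n} G (suc m) =
  Σ (Fin (suc m) → Fin n) λ c →
    Injective _≡_ _≡_ c
    × (∀ (i : Fin m) → Adj G (c (inject₁ i)) (c (suc i)))
    × Adj G (c (fromℕ m)) (c zero)

Bipartite : ∀ {n} → Graph n → Set
Bipartite {n} G = Σ (Fin n → Bool) λ f → ∀ u v → Adj G u v → f u ≢ f v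

degBound : (n k Δ : ℕ) → ℚ
degBound n zero Δ = ℚ.0ℚ
degBound n (suc j) Δ =
  ((+ n / (suc j + 1)) ℚ.- (+ Δ / (2 * suc j + 2)))
  ℚ.⊓ (((+ n - + 1) - + Δ) / suc j)

{-# OPTIONS --safe #-}
module Submission where

-- Take a shortest odd closed walk; it is an odd cycle c₀ c₁ … c_{L-1}.  If L ≤ 2k+1 this
-- contradicts the hypothesis, so L ≥ 2k+3 ≥ 7.  Minimality of L then forces: every vertex
-- has at most two neighbours on the cycle, and for a vertex v of maximum degree Δ the cycle
-- vertices reachable from v in two steps lie, after rotating the cycle, among c₀, c₂, c₄.
-- Double counting the edges between the cycle and V(G) gives (L-1)δ + Δ ≤ 2n, and counting
-- only the edges towards non-neighbours of v gives (L-3)δ + 2 ≤ 2(n - Δ).  For L ≥ 2k+3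
-- these say that δ is at most both terms of the minimum.  So there is no odd closed walk,
-- and colouring each vertex by the parity of its walks from a root of its component works.

open import Defs
open import Data.Nat using (ℕ; _≤_; _+_; _*_)
open import Data.Integer using (+_)
open import Data.Rational using (_<_; _/_)
open import Relation.Nullary using (¬_)

open import Data.Bool using (Bool; true; false; if_then_else_; not; _∧_)
import Data.Bool as Bool
open import Data.Bool.Properties using (¬-not)
open import Data.Empty using (⊥; ⊥-elim)
open import Data.Fin as Fin using (Fin; toℕ)
open import Data.Fin.Patterns using (2F)
import Data.Fin.Properties as FinP
import Data.Fin.Subset.Properties as SubsetP
import Data.Integer as ℤ
import Data.Integer.Properties as ℤP
import Data.List as List
import Data.List.Properties as ListP
import Data.List.Relation.Unary.All.Properties as AllP
import Data.List.Relation.Unary.Any.Properties as AnyP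
open import Data.Nat as ℕ using (zero; suc; parity; _%_; _∸_; _⊔_; _⊓_; z≤n; s≤s; _≤?_) renaming (_<_ to _<ₙ_)
open import Data.Nat.DivMod using (m≡m%n+[m/n]*n; [m+n]%n≡m%n; [m+kn]%n≡m%n; m%n<n; m<n⇒m%n≡m; n%n≡0)
open import Data.Nat.Induction using (<-rec)
open import Data.Nat.ListAction using () renaming (sum to sumList)
import Data.Nat.Properties as ℕP
open import Data.Nat.Tactic.RingSolver using (solve-∀)
open import Data.Parity using (0ℙ; 1ℙ; _⁻¹) renaming (_+_ to _+ℙ_)
import Data.Parity.Properties as ℙP
open import Data.Product using (∃; ∃-syntax; _×_; _,_; uncurry)
import Data.Rational as ℚ
import Data.Rational.Properties as ℚP
open import Data.Rational.Unnormalised as ℚᵘ using (mkℚᵘ)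
import Data.Rational.Unnormalised.Properties as ℚᵘP
open import Data.Sum using (_⊎_; inj₁; inj₂; [_,_]′)
import Data.Vec as Vec
open import Data.Vec.Functional using (removeAt)
import Data.Vec.Properties as VecP
open import Function using (_∘_; id)
open import Relation.Binary using (tri<; tri≈; tri>)
open import Relation.Binary.PropositionalEquality as ≡ hiding ([_]; sym)
open import Relation.Nullary using (Dec; yes; no; does; ¬?)
open import Relation.Nullary.Decidable using (map′; decidable-stable; ¬¬-excluded-middle; _→-dec_; _×-dec_)
open import Relation.Unary using (Decidable)
open import Algebra.Properties.CommutativeMonoid.Sum ℕP.+-0-commutativeMonoid
  using (sum; sum-syntax; ∑-comm; ∑-distrib-+; sum-cong-≗; sum-remove)

[_] : Bool → ℕ
[ b ] = if b then 1 else 0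

∑-mono-≤ : ∀ {m} {f g : Fin m → ℕ} → (∀ i → f i ≤ g i) → ∑[ i < m ] f i ≤ ∑[ i < m ] g i
∑-mono-≤ {zero}  f≤g = z≤n
∑-mono-≤ {suc m} f≤g = ℕP.+-mono-≤ (f≤g Fin.zero) (∑-mono-≤ (f≤g ∘ Fin.suc))

∑-const : ∀ m c → ∑[ i < m ] c ≡ m * c
∑-const zero    c = refl
∑-const (suc m) c = cong (_+_ c) (∑-const m c)

∑-≥-const : ∀ {m c} {f : Fin m → ℕ} → (∀ i → c ≤ f i) → m * c ≤ ∑[ i < m ] f i
∑-≥-const {m} {c} c≤f = subst (_≤ _) (∑-const m c) (∑-mono-≤ c≤f)

∑-≤-const : ∀ {m c} {f : Fin m → ℕ} → (∀ i → f i ≤ c) → ∑[ i < m ] f i ≤ m * c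
∑-≤-const {m} {c} f≤c = subst (_ ≤_) (∑-const m c) (∑-mono-≤ f≤c)

term≤∑ : ∀ {m} (f : Fin m → ℕ) i → f i ≤ ∑[ j < m ] f j
term≤∑ {suc _} f i = subst (f i ≤_) (≡.sym (sum-remove f)) (ℕP.m≤m+n (f i) _)

∑-≥-except : ∀ {k c} (f : Fin (suc k) → ℕ) i → (∀ j → c ≤ f j) → f i + k * c ≤ ∑[ j < suc k ] f j
∑-≥-except {k} {c} f i c≤f = subst (f i + k * c ≤_) (≡.sym (sum-remove f))
                                    (ℕP.+-monoʳ-≤ (f i) (∑-≥-const {f = removeAt f i} λ _ → c≤f _))

sumList-allFin : ∀ n (f : Fin n → ℕ) → sumList (List.map f (List.allFin n)) ≡ ∑[ i < n ] f i
sumList-allFin n f = trans (cong sumList (ListP.map-tabulate id f)) (tabulated n f)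
  where
  tabulated : ∀ n (f : Fin n → ℕ) → sumList (List.tabulate f) ≡ ∑[ i < n ] f i
  tabulated zero    f = refl
  tabulated (suc n) f = cong (_+_ (f Fin.zero)) (tabulated n (f ∘ Fin.suc))

count : ℕ → (ℕ → Bool) → ℕ
count m b = ∑[ i < m ] [ b (toℕ i) ]

count-none : ∀ k b → (∀ i → i <ₙ k → b i ≡ false) → count k b ≡ 0
count-none zero    b _    = refl
count-none (suc k) b none = cong₂ _+_ (cong [_] (none 0 (s≤s z≤n)))
                                      (count-none k (b ∘ suc) λ i i<k → none (suc i) (s≤s i<k))

count-window : ∀ k b → b 1 ≡ false → b 3 ≡ false → (∀ i → i <ₙ k → b (5 + i) ≡ false) →
               count (5 + k) b ≡ [ b 0 ] + ([ b 2 ] + [ b 4 ])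
count-window k b b1 b3 rest rewrite b1 | b3 | count-none k (λ i → b (5 + i)) rest =
  cong (λ c → [ b 0 ] + ([ b 2 ] + c)) (ℕP.+-identityʳ [ b 4 ])

ends-exclusive : ∀ a b c → (a ≡ true → c ≡ true → ⊥) → [ a ] + ([ b ] + [ c ]) ≤ 1 + [ b ]
ends-exclusive true  _     true  not-both = ⊥-elim (not-both refl refl)
ends-exclusive true  true  false _ = ℕP.≤-refl
ends-exclusive true  false false _ = ℕP.≤-refl
ends-exclusive false true  true  _ = ℕP.≤-refl
ends-exclusive false false true  _ = ℕP.≤-refl
ends-exclusive false true  false _ = ℕP.n≤1+n 1
ends-exclusive false false false _ = z≤n

count≥1 : ∀ m b → 1 ≤ count m b → ∃[ i ] i <ₙ m × b i ≡ true
count≥1 (suc m) b c with b 0 in b0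
... | true  = 0 , s≤s z≤n , b0
... | false with count≥1 m (b ∘ suc) c
...   | i , i<m , bi = suc i , s≤s i<m , bi

count≥2 : ∀ m b → 2 ≤ count m b → ∃[ i ] ∃[ j ] i <ₙ j × j <ₙ m × b i ≡ true × b j ≡ true
count≥2 (suc m) b c with b 0 in b0
... | true with count≥1 m (b ∘ suc) (ℕP.≤-pred c)
...   | j , j<m , bj = 0 , suc j , s≤s z≤n , s≤s j<m , b0 , bj
count≥2 (suc m) b c | false with count≥2 m (b ∘ suc) c
...   | i , j , i<j , j<m , bi , bj = suc i , suc j , s≤s i<j , s≤s j<m , bi , bj

count≥3 : ∀ m b → 3 ≤ count m b →
          ∃[ i ] ∃[ j ] ∃[ l ] i <ₙ j × j <ₙ l × l <ₙ m × b i ≡ true × b j ≡ true × b l ≡ true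
count≥3 (suc m) b c with b 0 in b0
... | true with count≥2 m (b ∘ suc) (ℕP.≤-pred c)
...   | j , l , j<l , l<m , bj , bl = 0 , suc j , suc l , s≤s z≤n , s≤s j<l , s≤s l<m , b0 , bj , bl
count≥3 (suc m) b c | false with count≥3 m (b ∘ suc) c
...   | i , j , l , i<j , j<l , l<m , bi , bj , bl =
  suc i , suc j , suc l , s≤s i<j , s≤s j<l , s≤s l<m , bi , bj , bl

module _ {n} (G : Graph n) where

  deg≡∑ : ∀ v → deg G v ≡ ∑[ w < n ] [ adj G v w ]
  deg≡∑ v = sumList-allFin n (λ w → [ adj G v w ])

  maxDeg-attained : Fin n → ∃[ v ] maxDeg G ≤ deg G v
  maxDeg-attained u = ListP.foldr-preservesᵇ {P = λ x → ∃[ v ] x ≤ deg G v} ⊔-closed (u , z≤n)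
    (AllP.map⁺ (AllP.tabulate⁺ (λ v → v , ℕP.≤-refl)))
    where
    ⊔-closed : ∀ {x y} → ∃[ v ] x ≤ deg G v → ∃[ w ] y ≤ deg G w → ∃[ v ] x ⊔ y ≤ deg G v
    ⊔-closed {x} {y} (v , x≤) (w , y≤) with ℕP.⊔-sel x y
    ... | inj₁ x⊔y≡x = v , subst (_≤ deg G v) (≡.sym x⊔y≡x) x≤
    ... | inj₂ x⊔y≡y = w , subst (_≤ deg G w) (≡.sym x⊔y≡y) y≤

minDeg≤deg : ∀ {n} (G : Graph n) v → minDeg G ≤ deg G v
minDeg≤deg {suc _} G v = ListP.foldr-preservesᵒ {P = _≤ deg G v} {f = _⊓_}
  (λ x y → [ ℕP.m≤n⇒m⊓o≤n y , ℕP.m≤n⇒o⊓m≤n x ]′) _ _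
  (inj₂ (AnyP.map⁺ (AnyP.tabulate⁺ {f = id} v ℕP.≤-refl)))

parity-suc : ∀ l → parity (suc l) ≡ parity l ⁻¹
parity-suc l = ℙP.+-homo-+ 1 l

parity-+ : ∀ a b {p q} → parity a ≡ p → parity b ≡ q → parity (a + b) ≡ p +ℙ q
parity-+ a b refl refl = ℙP.+-homo-+ a b

even-positive-≤4 : ∀ {d} → parity d ≡ 0ℙ → 0 <ₙ d → d ≤ 4 → d ≡ 2 ⊎ d ≡ 4
even-positive-≤4 {2} _ _ _ = inj₁ refl
even-positive-≤4 {4} _ _ _ = inj₂ refl
even-positive-≤4 {1} ()
even-positive-≤4 {3} ()
even-positive-≤4 {suc (suc (suc (suc (suc _))))} _ _ (s≤s (s≤s (s≤s (s≤s ()))))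

even-positive-≤2 : ∀ {d} → parity d ≡ 0ℙ → 0 <ₙ d → d ≤ 2 → d ≡ 2
even-positive-≤2 even-d 0<d d≤2 with even-positive-≤4 even-d 0<d (ℕP.≤-trans d≤2 (ℕP.m≤n+m 2 2))
... | inj₁ d≡2 = d≡2
... | inj₂ refl = ⊥-elim (ℕP.<⇒≱ (s≤s (s≤s (s≤s z≤n))) d≤2)

odd⇒2j+1 : ∀ l → parity l ≡ 1ℙ → ∃[ j ] 2 * j + 1 ≡ l
odd⇒2j+1 1 _ = 0 , refl
odd⇒2j+1 (suc (suc l)) odd with odd⇒2j+1 l odd
... | j , 2j+1≡l = suc j , trans (two-more j) (cong (_+_ 2) 2j+1≡l)
  where
  two-more : ∀ j → 2 * suc j + 1 ≡ 2 + (2 * j + 1)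
  two-more = solve-∀

no-three-gaps : ∀ {L i j l} → 5 ≤ L → parity L ≡ 1ℙ → j <ₙ l →
                j ≡ 2 + i ⊎ 2 + j ≡ L + i → l ≡ 2 + i ⊎ 2 + l ≡ L + i → l ≡ 2 + j ⊎ 2 + l ≡ L + j → ⊥
no-three-gaps _ _ j<l (inj₁ refl) (inj₁ refl) _ = ℕP.<-irrefl refl j<l
no-three-gaps {L} {i} {j} 5≤L _ j<l (inj₂ ij) (inj₁ refl) _ = ℕP.<-irrefl refl (begin-strict
  L + i        ≡⟨ ij ⟨
  2 + j        <⟨ ℕP.+-monoʳ-< 2 j<l ⟩
  4 + i        ≤⟨ ℕP.+-monoˡ-≤ i (ℕP.≤-trans (ℕP.n≤1+n 4) 5≤L) ⟩
  L + i        ∎)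
  where open ℕP.≤-Reasoning
no-three-gaps _ _ j<l (inj₂ ij) (inj₂ il) _ = ℕP.<-irrefl (ℕP.+-cancelˡ-≡ 2 _ _ (trans ij (≡.sym il))) j<l
no-three-gaps {L} {i} _ odd _ (inj₁ refl) (inj₂ il) (inj₁ refl) with () ←
  trans (cong parity (ℕP.+-cancelʳ-≡ i 6 L il)) odd
no-three-gaps {L} {i} _ _ _ (inj₁ refl) (inj₂ il) (inj₂ jl) =
  ℕP.m≢1+n+m i {1} (ℕP.+-cancelˡ-≡ L _ _ (trans (≡.sym il) jl))

InWindow : ℕ → Set
InWindow j = j ≡ 0 ⊎ j ≡ 2 ⊎ j ≡ 4

1∉window : ¬ InWindow 1
1∉window (inj₂ (inj₁ ()))
1∉window (inj₂ (inj₂ ()))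

3∉window : ¬ InWindow 3
3∉window (inj₂ (inj₁ ()))
3∉window (inj₂ (inj₂ ()))

5+∉window : ∀ k → ¬ InWindow (5 + k)
5+∉window k (inj₂ (inj₁ ()))
5+∉window k (inj₂ (inj₂ ()))

rotation-offset : ∀ m a b c i → a + b ≡ 7 + c → (a + m) + ((b + m) + i) ≡ (7 + m) + ((c + m) + i)
rotation-offset m a b c i a+b≡7+c = begin
  (a + m) + ((b + m) + i)   ≡⟨ regroup a b m i ⟩
  (a + b) + (m + (m + i))   ≡⟨ cong (_+ (m + (m + i))) a+b≡7+c ⟩
  (7 + c) + (m + (m + i))   ≡⟨ regroup 7 c m i ⟨
  (7 + m) + ((c + m) + i)   ∎
  where
  open ≡-Reasoning
  regroup : ∀ a b m i → (a + m) + ((b + m) + i) ≡ (a + b) + (m + (m + i))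
  regroup = solve-∀

7+m≡5+m+2 : ∀ m → 7 + m ≡ (5 + m) + 2
7+m≡5+m+2 m = cong (_+_ 5) (ℕP.+-comm 2 m)

7+m≡3+m+4 : ∀ m → 7 + m ≡ (3 + m) + 4
7+m≡3+m+4 m = cong (_+_ 3) (ℕP.+-comm 4 m)

-- Bipartiteness from the absence of odd closed walks

record Least {n} (P : Fin n → Set) : Set where
  field
    min     : Fin n
    holds   : P min
    minimal : ∀ {j} → P j → min Fin.≤ j

least : ∀ {n} {P : Fin n → Set} → Decidable P → ∃ P → Least P
least {suc n} P? (i , Pi) with P? Fin.zero
... | yes P0 = record { min = Fin.zero ; holds = P0 ; minimal = λ _ → z≤n }
least {suc n} P? (Fin.zero  , Pi) | no ¬P0 = ⊥-elim (¬P0 Pi)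
least {suc n} {P} P? (Fin.suc i , Pi) | no ¬P0 = record
  { min = Fin.suc min ; holds = holds ; minimal = minimal′ }
  where
  open Least (least (P? ∘ Fin.suc) (i , Pi))
  minimal′ : ∀ {j} → P j → Fin.suc min Fin.≤ j
  minimal′ {Fin.zero}  P0  = ⊥-elim (¬P0 P0)
  minimal′ {Fin.suc j} Psj = s≤s (minimal Psj)

least-unique : ∀ {n} {P Q : Fin n → Set} → (∀ {j} → P j → Q j) → (∀ {j} → Q j → P j) →
               (x : Least P) (y : Least Q) → Least.min x ≡ Least.min y
least-unique P⇒Q Q⇒P x y = FinP.≤-antisym
  (Least.minimal x (Q⇒P (Least.holds y))) (Least.minimal y (P⇒Q (Least.holds x)))

¬¬-∀ : ∀ {n} {P : Fin n → Set} → (∀ i → ¬ ¬ P i) → ¬ ¬ (∀ i → P i)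
¬¬-∀ {zero}  ¬¬P ¬∀P = ¬∀P λ ()
¬¬-∀ {suc n} ¬¬P ¬∀P = ¬¬P Fin.zero λ P0 → ¬¬-∀ (¬¬P ∘ Fin.suc) λ P+ →
  ¬∀P λ { Fin.zero → P0 ; (Fin.suc i) → P+ i }

¬¬-decidable₂ : ∀ {n} (R : Fin n → Fin n → Set) → ¬ ¬ (∀ a b → Dec (R a b))
¬¬-decidable₂ R = ¬¬-∀ λ a → ¬¬-∀ λ b → ¬¬-excluded-middle

module _ {n} (G : Graph n) where

  Adj-sym : ∀ {u v} → Adj G u v → Adj G v u
  Adj-sym {u} {v} uv = trans (Graph.sym G v u) uv

  infixr 5 _∷_ _++_
  infixl 5 _∷ʳ_

  data Walk : Fin n → Fin n → ℕ → Set where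
    []  : ∀ {a} → Walk a a 0
    _∷_ : ∀ {a b c l} → Adj G a b → Walk b c l → Walk a c (suc l)

  _++_ : ∀ {a b c l m} → Walk a b l → Walk b c m → Walk a c (l + m)
  []      ++ q = q
  (e ∷ p) ++ q = e ∷ (p ++ q)

  _∷ʳ_ : ∀ {a b c l} → Walk a b l → Adj G b c → Walk a c (suc l)
  []       ∷ʳ e = e ∷ []
  (e′ ∷ p) ∷ʳ e = e′ ∷ (p ∷ʳ e)

  reverse : ∀ {a b l} → Walk a b l → Walk b a l
  reverse []      = []
  reverse (e ∷ p) = reverse p ∷ʳ Adj-sym e

  NoOddClosedWalkOfLength : ℕ → Set
  NoOddClosedWalkOfLength l = ∀ {a} → parity l ≡ 1ℙ → Walk a a l → ⊥

  OddClosedWalkFree : Set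
  OddClosedWalkFree = ∀ {l} → NoOddClosedWalkOfLength l

  NoShorterOddClosedWalk : ℕ → Set
  NoShorterOddClosedWalk L = ∀ {l} → l <ₙ L → NoOddClosedWalkOfLength l

  Connected : Fin n → Fin n → Set
  Connected a b = ∃ (Walk a b)

  EvenWalk : Fin n → Fin n → Set
  EvenWalk a b = ∃[ l ] parity l ≡ 0ℙ × Walk a b l

  module Colouring (connected? : ∀ a b → Dec (Connected a b)) (even? : ∀ a b → Dec (EvenWalk a b))
                   (free : OddClosedWalkFree) where

    root : ∀ u → Least (λ w → Connected w u)
    root u = least (λ w → connected? w u) (u , 0 , [])

    root-adj : ∀ {u v} → Adj G u v → Least.min (root u) ≡ Least.min (root v)
    root-adj uv = least-unique (λ (l , p) → suc l , p ∷ʳ uv) (λ (l , p) → suc l , p ∷ʳ Adj-sym uv)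
                               (root _) (root _)

    colour : Fin n → Bool
    colour u = does (even? (Least.min (root u)) u)

    even-parities-clash : ∀ {r u v} → Connected r u → Adj G u v → does (even? r u) ≢ does (even? r v)
    even-parities-clash {r} {u} {v} (l , p) uv with even? r u | even? r v
    ... | yes (l₁ , e₁ , p₁) | yes (l₂ , e₂ , p₂) = λ _ →
      free (parity-+ l₁ (suc l₂) e₁ (trans (parity-suc l₂) (cong _⁻¹ e₂))) (p₁ ++ uv ∷ reverse p₂)
    ... | no ¬e₁ | no ¬e₂ = λ _ → odd-or-even (parity l) refl
      where
      odd-or-even : ∀ q → parity l ≡ q → ⊥
      odd-or-even 0ℙ e = ¬e₁ (l , e , p)
      odd-or-even 1ℙ e = ¬e₂ (suc l , trans (parity-suc l) (cong _⁻¹ e) , p ∷ʳ uv)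
    ... | yes _ | no _ = λ ()
    ... | no _ | yes _ = λ ()

    colour-proper : ∀ u v → Adj G u v → colour u ≢ colour v
    colour-proper u v uv = subst (λ r → colour u ≢ does (even? r v)) (root-adj uv)
                                 (even-parities-clash (Least.holds (root u)) uv)

  -- Connectivity is only decided under a double negation; this is harmless because
  -- bipartiteness of a finite graph is decidable.
  oddClosedWalkFree⇒¬¬bipartite : OddClosedWalkFree → ¬ ¬ Bipartite G
  oddClosedWalkFree⇒¬¬bipartite free ¬bip =
    ¬¬-decidable₂ Connected λ connected? → ¬¬-decidable₂ EvenWalk λ even? →
      let open Colouring connected? even? free in ¬bip (colour , colour-proper)

  bipartite? : Dec (Bipartite G)
  bipartite? = map′ (λ (p , proper) → Vec.lookup p , proper)
                    (λ (f , proper) → Vec.tabulate f , subst-proper (λ u → ≡.sym (VecP.lookup∘tabulate f u)) proper)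
                    (SubsetP.anySubset? (λ p → proper? (Vec.lookup p)))
    where
    Proper : (Fin n → Bool) → Set
    Proper f = ∀ u v → Adj G u v → f u ≢ f v
    proper? : ∀ f → Dec (Proper f)
    proper? f = FinP.all? λ u → FinP.all? λ v → (adj G u v Bool.≟ true) →-dec ¬? (f u Bool.≟ f v)
    subst-proper : ∀ {f g} → (∀ u → f u ≡ g u) → Proper f → Proper g
    subst-proper f≗g proper u v uv gu≡gv = proper u v uv (trans (f≗g u) (trans gu≡gv (≡.sym (f≗g v))))

  oddClosedWalkFree⇒bipartite : OddClosedWalkFree → Bipartite G
  oddClosedWalkFree⇒bipartite = decidable-stable bipartite? ∘ oddClosedWalkFree⇒¬¬bipartite

  vertexAt : ∀ {a b l} → Walk a b l → ℕ → Fin n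
  vertexAt {a} []      _       = a
  vertexAt {a} (_ ∷ _) zero    = a
  vertexAt     (_ ∷ p) (suc i) = vertexAt p i

  vertexAt-start : ∀ {a b l} (p : Walk a b l) → vertexAt p 0 ≡ a
  vertexAt-start []      = refl
  vertexAt-start (_ ∷ _) = refl

  vertexAt-end : ∀ {a b l} (p : Walk a b l) → vertexAt p l ≡ b
  vertexAt-end []      = refl
  vertexAt-end (_ ∷ p) = vertexAt-end p

  vertexAt-step : ∀ {a b l} (p : Walk a b l) {i} → i <ₙ l → Adj G (vertexAt p i) (vertexAt p (suc i))
  vertexAt-step (e ∷ p) {zero}  _         = subst (Adj G _) (≡.sym (vertexAt-start p)) e
  vertexAt-step (_ ∷ p) {suc i} (s≤s i<l) = vertexAt-step p i<l

  record CyclicWalk (L : ℕ) : Set where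
    field
      vertex   : ℕ → Fin n
      step     : ∀ i → Adj G (vertex i) (vertex (suc i))
      periodic : ∀ i → vertex (L + i) ≡ vertex i

  rotate : ∀ {L} → CyclicWalk L → ℕ → CyclicWalk L
  rotate {L} C r = record
    { vertex   = λ i → vertex (i + r)
    ; step     = λ i → step (i + r)
    ; periodic = λ i → trans (cong vertex (ℕP.+-assoc L i r)) (periodic (i + r))
    }
    where open CyclicWalk C

  closedWalk→cyclic : ∀ {a L} → Walk a a (suc L) → CyclicWalk (suc L)
  closedWalk→cyclic {a} {L} p = record { vertex = vertex ; step = step ; periodic = periodic }
    where
    M = suc L
    vertex : ℕ → Fin n
    vertex i = vertexAt p (i % M)
    periodic : ∀ i → vertex (M + i) ≡ vertex i
    periodic i = cong (vertexAt p) (trans (cong (_% M) (ℕP.+-comm M i)) ([m+n]%n≡m%n i M))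
    suc-% : ∀ i → suc i % M ≡ suc (i % M) % M
    suc-% i = trans (cong (λ j → suc j % M) (m≡m%n+[m/n]*n i M)) ([m+kn]%n≡m%n (suc (i % M)) (i ℕ./ M) M)
    next : ∀ i → vertex (suc i) ≡ vertexAt p (suc (i % M))
    next i with ℕP.m≤n⇒m<n∨m≡n (m%n<n i M)
    ... | inj₁ r+1<M = cong (vertexAt p) (trans (suc-% i) (m<n⇒m%n≡m r+1<M))
    ... | inj₂ r+1≡M = begin
      vertexAt p (suc i % M)    ≡⟨ cong (vertexAt p) (trans (suc-% i) (trans (cong (_% M) r+1≡M) (n%n≡0 M))) ⟩
      vertexAt p 0              ≡⟨ vertexAt-start p ⟩
      a                         ≡⟨ vertexAt-end p ⟨
      vertexAt p M              ≡⟨ cong (vertexAt p) r+1≡M ⟨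
      vertexAt p (suc (i % M))  ∎
      where open ≡-Reasoning
    step : ∀ i → Adj G (vertex i) (vertex (suc i))
    step i = subst (Adj G (vertex i)) (≡.sym (next i)) (vertexAt-step p (m%n<n i M))

  cyclic→ContainsCycle : ∀ {m} (C : CyclicWalk (suc m)) →
    (∀ {i j} → i <ₙ j → j <ₙ suc m → CyclicWalk.vertex C i ≢ CyclicWalk.vertex C j) → ContainsCycle G (suc m)
  cyclic→ContainsCycle {m} C distinct = c , injective , adjacent , closing
    where
    open CyclicWalk C
    c : Fin (suc m) → Fin n
    c i = vertex (toℕ i)
    injective : ∀ {x y} → c x ≡ c y → x ≡ y
    injective {x} {y} cx≡cy with ℕP.<-cmp (toℕ x) (toℕ y)
    ... | tri< x<y _ _ = ⊥-elim (distinct x<y (FinP.toℕ<n y) cx≡cy)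
    ... | tri≈ _ x≡y _ = FinP.toℕ-injective x≡y
    ... | tri> _ _ y<x = ⊥-elim (distinct y<x (FinP.toℕ<n x) (≡.sym cx≡cy))
    adjacent : ∀ i → Adj G (c (Fin.inject₁ i)) (c (Fin.suc i))
    adjacent i = subst (λ j → Adj G (vertex j) (vertex (suc (toℕ i)))) (≡.sym (FinP.toℕ-inject₁ i)) (step (toℕ i))
    closing : Adj G (c (Fin.fromℕ m)) (c Fin.zero)
    closing = subst₂ (Adj G) (cong vertex (≡.sym (FinP.toℕ-fromℕ m)))
                     (trans (cong vertex (≡.sym (ℕP.+-identityʳ (suc m)))) (periodic 0)) (step m)

  module ShortestOdd {L} (C : CyclicWalk L) (odd : parity L ≡ 1ℙ) (shortest : NoShorterOddClosedWalk L) where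
    open CyclicWalk C

    arc : ∀ i d → Walk (vertex i) (vertex (d + i)) d
    arc i zero    = []
    arc i (suc d) = arc i d ∷ʳ step (d + i)

    arc-around : ∀ {i d e} → d + e ≡ L → Walk (vertex (d + i)) (vertex i) e
    arc-around {i} {d} {e} d+e≡L =
      subst (λ u → Walk (vertex (d + i)) u e) (trans (cong vertex e+d+i≡L+i) (periodic i)) (arc (d + i) e)
      where
      e+d+i≡L+i : e + (d + i) ≡ L + i
      e+d+i≡L+i = trans (≡.sym (ℕP.+-assoc e d i)) (cong (_+ i) (trans (ℕP.+-comm e d) d+e≡L))

    odd-closed-walk-long : ∀ {a l} → parity l ≡ 1ℙ → Walk a a l → L ≤ l
    odd-closed-walk-long odd-l p = ℕP.≮⇒≥ λ l<L → shortest l<L odd-l p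

    parity-split : ∀ {d e} → d + e ≡ L →
                   (parity d ≡ 0ℙ × parity e ≡ 1ℙ) ⊎ (parity d ≡ 1ℙ × parity e ≡ 0ℙ)
    parity-split {d} {e} d+e≡L with parity d in pd | parity e in pe
    ... | 0ℙ | 1ℙ = inj₁ (refl , refl)
    ... | 1ℙ | 0ℙ = inj₂ (refl , refl)
    ... | 0ℙ | 0ℙ with () ← trans (≡.sym (parity-+ d e pd pe)) (trans (cong parity d+e≡L) odd)
    ... | 1ℙ | 1ℙ with () ← trans (≡.sym (parity-+ d e pd pe)) (trans (cong parity d+e≡L) odd)

    -- The even walk closes up with the odd one of the two arcs into an odd closed walk,
    -- which by minimality has length at least L = d + e.
    even-bridge : ∀ {i d e p} → d + e ≡ L → parity p ≡ 0ℙ → Walk (vertex (d + i)) (vertex i) p →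
                  (parity d ≡ 0ℙ × d ≤ p) ⊎ (parity e ≡ 0ℙ × e ≤ p)
    even-bridge {i} {d} {e} {p} d+e≡L even-p q with parity-split {d} {e} d+e≡L
    ... | inj₁ (even-d , odd-e) = inj₁ (even-d , ℕP.+-cancelʳ-≤ e d p
            (subst₂ _≤_ (≡.sym d+e≡L) (ℕP.+-comm e p)
                    (odd-closed-walk-long (parity-+ e p odd-e even-p) (arc-around d+e≡L ++ reverse q))))
    ... | inj₂ (odd-d , even-e) = inj₂ (even-e , ℕP.+-cancelˡ-≤ d e p
            (subst (_≤ d + p) (≡.sym d+e≡L)
                   (odd-closed-walk-long (parity-+ d p odd-d even-p) (arc i d ++ q))))

    complement : ∀ {d} → 0 <ₙ d → d <ₙ L → ∃[ e ] d + e ≡ L × 0 <ₙ e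
    complement {d} _ d<L = L ∸ d , ℕP.m+[n∸m]≡n (ℕP.<⇒≤ d<L) , ℕP.m<n⇒0<n∸m d<L

    positions→gaps : ∀ {i j} → i <ₙ j → j <ₙ L →
                     ∃[ d ] ∃[ e ] d + e ≡ L × 0 <ₙ d × 0 <ₙ e × d + i ≡ j
    positions→gaps {i} {j} i<j j<L =
      let e , d+e≡L , 0<e = complement 0<d (ℕP.≤-<-trans (ℕP.m∸n≤m j i) j<L)
      in j ∸ i , e , d+e≡L , 0<d , 0<e , ℕP.m∸n+n≡m (ℕP.<⇒≤ i<j)
      where
      0<d : 0 <ₙ j ∸ i
      0<d = ℕP.m<n⇒0<n∸m i<j

    vertex-injective : ∀ {i j} → i <ₙ j → j <ₙ L → vertex i ≢ vertex j
    vertex-injective {i} i<j j<L vi≡vj with positions→gaps i<j j<L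
    ... | d , e , d+e≡L , 0<d , 0<e , refl
        with even-bridge d+e≡L refl (subst (λ u → Walk u (vertex i) 0) vi≡vj [])
    ...   | inj₁ (_ , d≤0) = ℕP.<⇒≱ 0<d d≤0
    ...   | inj₂ (_ , e≤0) = ℕP.<⇒≱ 0<e e≤0

    neighbour-positions : ∀ {x i j} → i <ₙ j → j <ₙ L → Adj G x (vertex i) → Adj G x (vertex j) →
                          j ≡ 2 + i ⊎ 2 + j ≡ L + i
    neighbour-positions {i = i} i<j j<L xi xj with positions→gaps i<j j<L
    ... | d , e , d+e≡L , 0<d , 0<e , refl with even-bridge d+e≡L refl (Adj-sym xj ∷ xi ∷ [])
    ...   | inj₁ (even-d , d≤2) = inj₁ (cong (_+ i) (even-positive-≤2 even-d 0<d d≤2))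
    ...   | inj₂ (even-e , e≤2) = inj₂ (begin
      2 + (d + i) ≡⟨ cong (λ k → k + (d + i)) (even-positive-≤2 even-e 0<e e≤2) ⟨
      e + (d + i) ≡⟨ ℕP.+-assoc e d i ⟨
      e + d + i   ≡⟨ cong (_+ i) (trans (ℕP.+-comm e d) d+e≡L) ⟩
      L + i       ∎)
      where open ≡-Reasoning

    neighbours-on-cycle≤2 : 5 ≤ L → ∀ x → count L (λ i → adj G x (vertex i)) ≤ 2
    neighbours-on-cycle≤2 5≤L x = ℕP.≮⇒≥ λ 2<count →
      let i , j , l , i<j , j<l , l<L , xi , xj , xl = count≥3 L (λ i → adj G x (vertex i)) 2<count
          j<L = ℕP.<-trans j<l l<L
      in no-three-gaps 5≤L odd j<l (neighbour-positions i<j j<L xi xj)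
                       (neighbour-positions (ℕP.<-trans i<j j<l) l<L xi xl) (neighbour-positions j<l l<L xj xl)

    two-steps-gap : ∀ {v i d e} → d + e ≡ L → 0 <ₙ d → 0 <ₙ e →
                    Walk v (vertex i) 2 → Walk v (vertex (d + i)) 2 → (d ≡ 2 ⊎ d ≡ 4) ⊎ (e ≡ 2 ⊎ e ≡ 4)
    two-steps-gap d+e≡L 0<d 0<e p q with even-bridge d+e≡L refl (reverse q ++ p)
    ... | inj₁ (even-d , d≤4) = inj₁ (even-positive-≤4 even-d 0<d d≤4)
    ... | inj₂ (even-e , e≤4) = inj₂ (even-positive-≤4 even-e 0<e e≤4)

    two-steps-forbidden : ∀ {v i d e} → d + e ≡ L → parity d ≡ 0ℙ → 4 <ₙ d →
                          Walk v (vertex i) 2 → ¬ Walk v (vertex (d + i)) 2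
    two-steps-forbidden {d = d} {e} d+e≡L even-d 4<d p q with even-bridge d+e≡L refl (reverse q ++ p)
    ... | inj₁ (_ , d≤4) = ℕP.<⇒≱ 4<d d≤4
    ... | inj₂ (even-e , _) with parity-split {d} {e} d+e≡L
    ...   | inj₁ (_ , odd-e) with () ← trans (≡.sym even-e) odd-e
    ...   | inj₂ (odd-d , _) with () ← trans (≡.sym even-d) odd-d

  shortest-odd-closed-walk⇒cycle : ∀ {a l} → NoShorterOddClosedWalk l → parity l ≡ 1ℙ → Walk a a l →
                                   ContainsCycle G l
  shortest-odd-closed-walk⇒cycle {l = suc l} shortest odd p =
    cyclic→ContainsCycle C (ShortestOdd.vertex-injective C odd shortest)
    where C = closedWalk→cyclic p

  Canonical : ∀ {L} → CyclicWalk L → Fin n → Set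
  Canonical {L} C v = ∀ j → j <ₙ L → Walk v (CyclicWalk.vertex C j) 2 → InWindow j

  walk₂? : ∀ u w → Dec (Walk u w 2)
  walk₂? u w = map′ (λ (x , ux , xw) → ux ∷ xw ∷ []) (λ { (ux ∷ xw ∷ []) → _ , ux , xw })
                    (FinP.any? λ x → (adj G u x Bool.≟ true) ×-dec (adj G x w Bool.≟ true))

  -- (3 + m) + ((3 + m) + i) is position i - 8 modulo 7 + m: it is i + 6 when m = 0,
  -- and it wraps around to (m - 1) + i otherwise.
  ¬two-steps-8-before : ∀ {m} (C : CyclicWalk (7 + m)) → parity (7 + m) ≡ 1ℙ → NoShorterOddClosedWalk (7 + m) →
                        ∀ {v i} → Walk v (CyclicWalk.vertex C i) 2 →
                        ¬ Walk v (CyclicWalk.vertex C ((3 + m) + ((3 + m) + i))) 2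
  ¬two-steps-8-before {zero} C odd shortest p =
    ShortestOdd.two-steps-forbidden C odd shortest refl refl (ℕP.n≤1+n 5) p
  ¬two-steps-8-before {suc m} C odd shortest {v} {i} p q =
    ShortestOdd.two-steps-forbidden C odd shortest {d = 8} refl refl (ℕP.m≤m+n 5 3)
      (subst (λ u → Walk v u 2) (trans (cong vertex (wrap m i)) (periodic (m + i))) q)
      (subst (λ u → Walk v u 2) (≡.sym (periodic i)) p)
    where
    open CyclicWalk C
    wrap : ∀ m i → (3 + suc m) + ((3 + suc m) + i) ≡ (7 + suc m) + (m + i)
    wrap = solve-∀

  module LongShortestOdd {m} (odd : parity (7 + m) ≡ 1ℙ) (shortest : NoShorterOddClosedWalk (7 + m)) where

    5≤7+m : 5 ≤ 7 + m
    5≤7+m = ℕP.m≤m+n 5 (2 + m)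

    module _ (C : CyclicWalk (7 + m)) (v : Fin n) where
      open CyclicWalk C
      open ShortestOdd C odd shortest

      private
        TwoSteps : ℕ → Set
        TwoSteps k = Walk v (vertex k) 2

      two-steps-periodic : ∀ {k} → TwoSteps ((7 + m) + k) → TwoSteps k
      two-steps-periodic = subst (λ u → Walk v u 2) (periodic _)

      ¬two-steps-6-before : ∀ {i} → TwoSteps i → ¬ TwoSteps ((1 + m) + i)
      ¬two-steps-6-before {i} p q = two-steps-forbidden {d = 6} refl refl (ℕP.n≤1+n 5) q
                                      (subst (λ u → Walk v u 2) (≡.sym (periodic i)) p)

      canonical-at : ∀ {r} → TwoSteps r → ¬ TwoSteps ((5 + m) + r) → ¬ TwoSteps ((3 + m) + r) →
                     Canonical (rotate C r) v
      canonical-at _ _ _ zero _ _ = inj₁ refl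
      canonical-at {r} at-r ¬at-r-2 ¬at-r-4 (suc j) j<L at-j with complement (s≤s z≤n) j<L
      ... | e , d+e≡L , 0<e with two-steps-gap d+e≡L (s≤s z≤n) 0<e at-r at-j
      ...   | inj₁ (inj₁ d≡2)  = inj₂ (inj₁ d≡2)
      ...   | inj₁ (inj₂ d≡4)  = inj₂ (inj₂ d≡4)
      ...   | inj₂ (inj₁ refl) = ⊥-elim (¬at-r-2 (subst (λ d → TwoSteps (d + r))
                                   (ℕP.+-cancelʳ-≡ 2 _ _ (trans d+e≡L (7+m≡5+m+2 m))) at-j))
      ...   | inj₂ (inj₂ refl) = ⊥-elim (¬at-r-4 (subst (λ d → TwoSteps (d + r))
                                   (ℕP.+-cancelʳ-≡ 4 _ _ (trans d+e≡L (7+m≡3+m+4 m))) at-j))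

      -- Two-step positions pairwise differ by ±2 or ±4, so they fit in an arc of length 4;
      -- starting from one of them, step back by 4 or by 2 to the start of that arc.
      canonical-rotation : ∃[ r ] Canonical (rotate C r) v
      canonical-rotation with FinP.any? (λ k → walk₂? v (vertex (toℕ k)))
      ... | yes (k , at-k) = from at-k
        where
        from : ∀ {i} → TwoSteps i → ∃[ r ] Canonical (rotate C r) v
        from {i} at-i with walk₂? v (vertex ((3 + m) + i)) | walk₂? v (vertex ((5 + m) + i))
        ... | no ¬at-i-4 | no ¬at-i-2 = i , canonical-at at-i ¬at-i-2 ¬at-i-4
        ... | yes at-i-4 | _ = (3 + m) + i , canonical-at at-i-4
              (¬two-steps-6-before at-i ∘ two-steps-periodic ∘ subst TwoSteps (rotation-offset m 5 3 1 i refl))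
              (¬two-steps-8-before C odd shortest at-i)
        ... | no ¬at-i-4 | yes at-i-2 = (5 + m) + i , canonical-at at-i-2
              (¬at-i-4 ∘ two-steps-periodic ∘ subst TwoSteps (rotation-offset m 5 5 3 i refl))
              (¬two-steps-6-before at-i ∘ two-steps-periodic ∘ subst TwoSteps (rotation-offset m 3 5 1 i refl))
      ... | no none = 0 , λ j j<L at-j → ⊥-elim (none (Fin.fromℕ< j<L ,
              subst TwoSteps (≡.sym (trans (FinP.toℕ-fromℕ< j<L) (≡.sym (ℕP.+-identityʳ j)))) at-j))

    -- Counting edges around a shortest odd cycle

    module Counting (C : CyclicWalk (7 + m)) (v : Fin n) (canonical : Canonical C v) where
      open CyclicWalk C
      open ShortestOdd C odd shortest

      δ : ℕ
      δ = minDeg G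

      on-cycle : Fin n → ℕ
      on-cycle x = count (7 + m) (λ i → adj G x (vertex i))

      neighbour-in-window : ∀ {x i} → Adj G v x → i <ₙ 7 + m → Adj G x (vertex i) → InWindow i
      neighbour-in-window vx i<L xi = canonical _ i<L (vx ∷ xi ∷ [])

      off-window : ∀ {x i} → Adj G v x → i <ₙ 7 + m → ¬ InWindow i → adj G x (vertex i) ≡ false
      off-window vx i<L i∉ = ¬-not (i∉ ∘ neighbour-in-window vx i<L)

      neighbour-of-v-on-cycle : ∀ {x} → Adj G v x → on-cycle x ≤ 1 + [ adj G x (vertex 2) ]
      neighbour-of-v-on-cycle {x} vx = subst (_≤ 1 + [ adj G x (vertex 2) ])
        (≡.sym (count-window (2 + m) (λ i → adj G x (vertex i))
          (off-window vx (ℕP.m≤m+n 2 (5 + m)) 1∉window) (off-window vx (ℕP.m≤m+n 4 (3 + m)) 3∉window)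
          (λ i i<2+m → off-window vx (ℕP.+-monoʳ-< 5 i<2+m) (5+∉window i))))
        (ends-exclusive _ _ _ not-both)
        where
        not-both : Adj G x (vertex 0) → Adj G x (vertex 4) → ⊥
        not-both x0 x4 with neighbour-positions {i = 0} {j = 4} (s≤s z≤n) (ℕP.m≤m+n 5 (2 + m)) x0 x4
        ... | inj₂ ()

      on-cycle-bound : ∀ x → on-cycle x + [ adj G v x ] ≤ 2 + [ adj G (vertex 2) x ]
      on-cycle-bound x with adj G v x in vx
      ... | true  = subst (λ b → on-cycle x + 1 ≤ 2 + [ b ]) (Graph.sym G x (vertex 2))
                          (subst (_≤ 2 + [ adj G x (vertex 2) ]) (ℕP.+-comm 1 (on-cycle x))
                                 (s≤s (neighbour-of-v-on-cycle vx)))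
      ... | false = ℕP.≤-trans (ℕP.≤-reflexive (ℕP.+-identityʳ (on-cycle x)))
                               (ℕP.≤-trans (neighbours-on-cycle≤2 5≤7+m x) (ℕP.m≤m+n 2 [ adj G (vertex 2) x ]))

      ∑-on-cycle : ∑[ x < n ] on-cycle x ≡ ∑[ i < 7 + m ] deg G (vertex (toℕ i))
      ∑-on-cycle = trans (∑-comm {n} {7 + m} λ x i → [ adj G x (vertex (toℕ i)) ]) (sum-cong-≗ column)
        where
        column : ∀ (i : Fin (7 + m)) → ∑[ x < n ] [ adj G x (vertex (toℕ i)) ] ≡ deg G (vertex (toℕ i))
        column i = trans (sum-cong-≗ λ x → cong [_] (Graph.sym G x (vertex (toℕ i))))
                         (≡.sym (deg≡∑ G (vertex (toℕ i))))

      cycle-degrees-bound : (6 + m) * δ + deg G v ≤ 2 * n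
      cycle-degrees-bound = ℕP.+-cancelˡ-≤ deg₂ _ _ (begin
        deg₂ + ((6 + m) * δ + deg G v)              ≡⟨ ℕP.+-assoc deg₂ _ _ ⟨
        deg₂ + (6 + m) * δ + deg G v                ≤⟨ ℕP.+-monoˡ-≤ (deg G v) (∑-≥-except degrees 2F λ _ → minDeg≤deg G _) ⟩
        ∑[ i < 7 + m ] degrees i + deg G v          ≡⟨ cong₂ _+_ ∑-on-cycle (≡.sym (deg≡∑ G v)) ⟨
        ∑[ x < n ] on-cycle x + ∑[ x < n ] to-v x   ≡⟨ ∑-distrib-+ on-cycle to-v ⟨
        ∑[ x < n ] (on-cycle x + to-v x)            ≤⟨ ∑-mono-≤ on-cycle-bound ⟩
        ∑[ x < n ] (2 + to-c₂ x)                    ≡⟨ ∑-distrib-+ (λ _ → 2) to-c₂ ⟩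
        ∑[ x < n ] 2 + ∑[ x < n ] to-c₂ x           ≡⟨ cong₂ _+_ (trans (∑-const n 2) (ℕP.*-comm n 2)) (≡.sym (deg≡∑ G _)) ⟩
        2 * n + deg₂                                ≡⟨ ℕP.+-comm (2 * n) deg₂ ⟩
        deg₂ + 2 * n                                ∎)
        where
        open ℕP.≤-Reasoning
        deg₂ : ℕ
        deg₂ = deg G (vertex 2)
        degrees : Fin (7 + m) → ℕ
        degrees i = deg G (vertex (toℕ i))
        to-v to-c₂ : Fin n → ℕ
        to-v x = [ adj G v x ]
        to-c₂ x = [ adj G (vertex 2) x ]

      outer-degree : ℕ → ℕ
      outer-degree i = ∑[ x < n ] [ not (adj G v x) ∧ adj G x (vertex i) ]

      outer-degree-off-window : ∀ {i} → i <ₙ 7 + m → ¬ InWindow i → δ ≤ outer-degree i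
      outer-degree-off-window {i} i<L i∉ =
        subst (δ ≤_) (trans (deg≡∑ G (vertex i)) (sum-cong-≗ same)) (minDeg≤deg G _)
        where
        same : ∀ x → [ adj G (vertex i) x ] ≡ [ not (adj G v x) ∧ adj G x (vertex i) ]
        same x with adj G v x in vx
        ... | false = cong [_] (Graph.sym G (vertex i) x)
        ... | true  = cong [_] (trans (Graph.sym G _ x) (off-window vx i<L i∉))

      outer-degree-pos : ∀ {i} x → adj G v x ≡ false → Adj G x (vertex i) → 1 ≤ outer-degree i
      outer-degree-pos {i} x v≁x xi =
        ℕP.≤-trans (ℕP.≤-reflexive (≡.sym (cong₂ (λ a b → [ not a ∧ b ]) v≁x xi)))
                   (term≤∑ (λ x → [ not (adj G v x) ∧ adj G x (vertex i) ]) x)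

      ∑-outer-degree≥ : (4 + m) * δ + 2 ≤ ∑[ i < 7 + m ] outer-degree (toℕ i)
      ∑-outer-degree≥ = subst (_≤ ∑[ i < 7 + m ] outer-degree (toℕ i)) (regroup m δ)
        (ℕP.+-mono-≤ outer-0 (ℕP.+-mono-≤ (outer-degree-off-window (ℕP.m≤m+n 2 (5 + m)) 1∉window)
          (ℕP.+-mono-≤ (z≤n {outer-degree 2}) (ℕP.+-mono-≤ (outer-degree-off-window (ℕP.m≤m+n 4 (3 + m)) 3∉window)
            (ℕP.+-mono-≤ outer-4 (∑-≥-const {f = λ j → outer-degree (5 + toℕ j)} λ j →
              outer-degree-off-window (ℕP.+-monoʳ-< 5 (FinP.toℕ<n j)) (5+∉window (toℕ j))))))))
        where
        regroup : ∀ m δ → 1 + (δ + (0 + (δ + (1 + (2 + m) * δ)))) ≡ (4 + m) * δ + 2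
        regroup = solve-∀
        outer-0 : 1 ≤ outer-degree 0
        outer-0 = outer-degree-pos (vertex (6 + m))
          (¬-not λ vx → 5+∉window m (neighbour-in-window vx (ℕP.m≤n⇒m≤1+n ℕP.≤-refl) (Adj-sym (step (5 + m)))))
          (subst (Adj G (vertex (6 + m))) (trans (cong vertex (≡.sym (ℕP.+-identityʳ (7 + m)))) (periodic 0))
                 (step (6 + m)))
        outer-4 : 1 ≤ outer-degree 4
        outer-4 = outer-degree-pos (vertex 5)
          (¬-not λ vx → 5+∉window 1 (neighbour-in-window vx (ℕP.m≤m+n 7 m) (step 5)))
          (Adj-sym (step 4))

      outer : Fin n → ℕ
      outer x = count (7 + m) (λ i → not (adj G v x) ∧ adj G x (vertex i))

      outer-bound : ∀ x → outer x + ([ adj G v x ] + [ adj G v x ]) ≤ 2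
      outer-bound x = by-adjacency (adj G v x)
        where
        by-adjacency : ∀ b → count (7 + m) (λ i → not b ∧ adj G x (vertex i)) + ([ b ] + [ b ]) ≤ 2
        by-adjacency true  = ℕP.≤-reflexive (cong (_+ 2) (count-none (7 + m) _ λ _ _ → refl))
        by-adjacency false = ℕP.≤-trans (ℕP.≤-reflexive (ℕP.+-identityʳ (on-cycle x)))
                                        (neighbours-on-cycle≤2 5≤7+m x)

      non-neighbour-bound : (4 + m) * δ + 2 + (deg G v + deg G v) ≤ 2 * n
      non-neighbour-bound = begin
        (4 + m) * δ + 2 + (deg G v + deg G v)                  ≤⟨ ℕP.+-monoˡ-≤ (deg G v + deg G v) ∑-outer-degree≥ ⟩
        ∑[ i < 7 + m ] outer-degree (toℕ i) + (deg G v + deg G v)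
          ≡⟨ cong₂ _+_ (∑-comm {7 + m} {n} λ i x → [ not (adj G v x) ∧ adj G x (vertex (toℕ i)) ])
                       (cong₂ _+_ (deg≡∑ G v) (deg≡∑ G v)) ⟩
        ∑[ x < n ] outer x + (∑[ x < n ] to-v x + ∑[ x < n ] to-v x)
          ≡⟨ trans (∑-distrib-+ outer (λ x → to-v x + to-v x))
                   (cong (_+_ (∑[ x < n ] outer x)) (∑-distrib-+ to-v to-v)) ⟨
        ∑[ x < n ] (outer x + (to-v x + to-v x))               ≤⟨ ∑-≤-const outer-bound ⟩
        n * 2                                                  ≡⟨ ℕP.*-comm n 2 ⟩
        2 * n                                                  ∎
        where
        open ℕP.≤-Reasoning
        to-v : Fin n → ℕ
        to-v x = [ adj G v x ]

    degree-bounds : ∀ {a} → Walk a a (7 + m) →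
                    (6 + m) * minDeg G + maxDeg G ≤ 2 * n × (4 + m) * minDeg G + 2 + (maxDeg G + maxDeg G) ≤ 2 * n
    degree-bounds {a} p =
      let v , Δ≤deg-v = maxDeg-attained G a
          r , canonical = canonical-rotation C v
          open Counting (rotate C r) v canonical
      in ℕP.≤-trans (ℕP.+-monoʳ-≤ ((6 + m) * minDeg G) Δ≤deg-v) cycle-degrees-bound ,
         ℕP.≤-trans (ℕP.+-monoʳ-≤ ((4 + m) * minDeg G + 2) (ℕP.+-mono-≤ Δ≤deg-v Δ≤deg-v)) non-neighbour-bound
      where C = closedWalk→cyclic p

-- Comparison with the degree bound

7≤2j+1 : ∀ {k j} → 2 ≤ k → k <ₙ j → 7 ≤ 2 * j + 1
7≤2j+1 2≤k k<j = ℕP.+-monoˡ-≤ 1 (ℕP.*-monoʳ-≤ 2 (ℕP.≤-trans (s≤s 2≤k) k<j))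

long-cycle-arithmetic : ∀ {k j m δ Δ n} → k <ₙ j → 2 * j + 1 ≡ 7 + m →
  (6 + m) * δ + Δ ≤ 2 * n → (4 + m) * δ + 2 + (Δ + Δ) ≤ 2 * n →
  (2 * k + 2) * δ + Δ ≤ 2 * n × k * δ + Δ + 1 ≤ n
long-cycle-arithmetic {k} {j} {m} {δ} {Δ} {n} k<j 2j+1≡7+m first second =
  ℕP.≤-trans (ℕP.+-monoˡ-≤ Δ (ℕP.*-monoˡ-≤ δ 2k+2≤6+m)) first ,
  ℕP.*-cancelˡ-≤ 2 (begin
    2 * (k * δ + Δ + 1)            ≡⟨ double k δ Δ ⟩
    (2 * k) * δ + 2 + (Δ + Δ)      ≤⟨ ℕP.+-monoˡ-≤ (Δ + Δ) (ℕP.+-monoˡ-≤ 2 (ℕP.*-monoˡ-≤ δ 2k≤4+m)) ⟩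
    (4 + m) * δ + 2 + (Δ + Δ)      ≤⟨ second ⟩
    2 * n                          ∎)
  where
  open ℕP.≤-Reasoning
  double : ∀ k δ Δ → 2 * (k * δ + Δ + 1) ≡ (2 * k) * δ + 2 + (Δ + Δ)
  double = solve-∀
  2j≡6+m : 2 * j ≡ 6 + m
  2j≡6+m = ℕP.suc-injective (trans (ℕP.+-comm 1 (2 * j)) 2j+1≡7+m)
  2k+2≤6+m : 2 * k + 2 ≤ 6 + m
  2k+2≤6+m = subst₂ _≤_ (trans (ℕP.*-suc 2 k) (ℕP.+-comm 2 (2 * k))) 2j≡6+m (ℕP.*-monoʳ-≤ 2 k<j)
  2k≤4+m : 2 * k ≤ 4 + m
  2k≤4+m = ℕP.+-cancelʳ-≤ 2 (2 * k) (4 + m) (subst (2 * k + 2 ≤_) (ℕP.+-comm 2 (4 + m)) 2k+2≤6+m)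

+≤+-∸ : ∀ {x y z} → x + y ≤ z → + x ℤ.≤ + z ℤ.- + y
+≤+-∸ {x} {y} {z} x+y≤z =
  subst (+ x ℤ.≤_) (≡.sym (trans (ℤP.m-n≡m⊖n z y) (ℤP.⊖-≥ (ℕP.≤-trans (ℕP.m≤n+m y x) x+y≤z))))
        (ℤ.+≤+ (ℕP.m+n≤o⇒m≤o∸n x x+y≤z))

-- Both comparisons go through the unnormalised rationals, where ≤ is cross-multiplication.
≤-/ : ∀ p q b → p ℤ.* + suc b ℤ.≤ q ℤ.* + 1 → p / 1 ℚ.≤ q / suc b
≤-/ p q b le = ℚP.toℚᵘ-cancel-≤ (ℚᵘP.≤-respˡ-≃ (ℚᵘP.≃-sym (ℚP.toℚᵘ-fromℚᵘ (mkℚᵘ p 0)))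
                 (ℚᵘP.≤-respʳ-≃ (ℚᵘP.≃-sym (ℚP.toℚᵘ-fromℚᵘ (mkℚᵘ q b))) (ℚᵘ.*≤* le)))

≤-/-difference : ∀ p q r a b →
                 p ℤ.* + (suc a * suc b) ℤ.≤ (q ℤ.* + suc b ℤ.+ ℤ.- r ℤ.* + suc a) ℤ.* + 1 →
                 p / 1 ℚ.≤ q / suc a ℚ.- r / suc b
≤-/-difference p q r a b le =
  ℚP.toℚᵘ-cancel-≤ (ℚᵘP.≤-respˡ-≃ (ℚᵘP.≃-sym (ℚP.toℚᵘ-fromℚᵘ (mkℚᵘ p 0)))
                   (ℚᵘP.≤-respʳ-≃ (ℚᵘP.≃-sym difference) (ℚᵘ.*≤* le)))
  where
  difference : ℚ.toℚᵘ (q / suc a ℚ.- r / suc b) ℚᵘ.≃ mkℚᵘ q a ℚᵘ.- mkℚᵘ r b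
  difference = ℚᵘP.≃-trans (ℚP.toℚᵘ-homo-+ (q / suc a) (ℚ.- (r / suc b)))
    (ℚᵘP.+-cong (ℚP.toℚᵘ-fromℚᵘ (mkℚᵘ q a))
                (ℚᵘP.≃-trans (ℚP.toℚᵘ-homo‿- (r / suc b)) (ℚᵘP.-‿cong (ℚP.toℚᵘ-fromℚᵘ (mkℚᵘ r b)))))

δ≤degBound : ∀ n k Δ δ → (2 * suc k + 2) * δ + Δ ≤ 2 * n → suc k * δ + Δ + 1 ≤ n →
             + δ / 1 ℚ.≤ degBound n (suc k) Δ
δ≤degBound n k Δ δ first second = ℚP.⊓-glb (≤-/-difference (+ δ) (+ n) (+ Δ) (k + 1) (ℕ.pred D) first′)
                                             (≤-/ (+ δ) ((+ n ℤ.- + 1) ℤ.- + Δ) k second′)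
  where
  K D : ℕ
  K = suc k + 1
  D = 2 * suc k + 2
  scaled : δ * (K * D) + Δ * K ≤ n * D
  scaled = subst₂ _≤_ (expand k δ Δ) (swap k n) (ℕP.*-monoʳ-≤ K first)
    where
    expand : ∀ k δ Δ → (suc k + 1) * ((2 * suc k + 2) * δ + Δ)
                     ≡ δ * ((suc k + 1) * (2 * suc k + 2)) + Δ * (suc k + 1)
    expand = solve-∀
    swap : ∀ k n → (suc k + 1) * (2 * n) ≡ n * (2 * suc k + 2)
    swap = solve-∀
  first′ : + δ ℤ.* + (K * D) ℤ.≤ (+ n ℤ.* + D ℤ.+ ℤ.- (+ Δ) ℤ.* + K) ℤ.* + 1
  first′ = subst₂ ℤ._≤_ (ℤP.pos-* δ (K * D)) (≡.sym (begin
    (+ n ℤ.* + D ℤ.+ ℤ.- (+ Δ) ℤ.* + K) ℤ.* + 1  ≡⟨ ℤP.*-identityʳ _ ⟩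
    + n ℤ.* + D ℤ.+ ℤ.- (+ Δ) ℤ.* + K            ≡⟨ cong₂ ℤ._+_ (ℤP.pos-* n D) (ℤP.neg-distribˡ-* (+ Δ) (+ K)) ⟨
    + (n * D) ℤ.+ ℤ.- (+ Δ ℤ.* + K)              ≡⟨ cong (λ x → + (n * D) ℤ.- x) (ℤP.pos-* Δ K) ⟨
    + (n * D) ℤ.- + (Δ * K)                      ∎)) (+≤+-∸ scaled)
    where open ≡-Reasoning
  second′ : + δ ℤ.* + suc k ℤ.≤ ((+ n ℤ.- + 1) ℤ.- + Δ) ℤ.* + 1
  second′ = subst₂ ℤ._≤_ (ℤP.pos-* δ (suc k)) (≡.sym (begin
    ((+ n ℤ.- + 1) ℤ.- + Δ) ℤ.* + 1     ≡⟨ ℤP.*-identityʳ _ ⟩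
    (+ n ℤ.- + 1) ℤ.- + Δ               ≡⟨ ℤP.+-assoc (+ n) (ℤ.- + 1) (ℤ.- + Δ) ⟩
    + n ℤ.+ (ℤ.- + 1 ℤ.+ ℤ.- + Δ)       ≡⟨ cong (λ x → + n ℤ.+ x) (ℤP.neg-distrib-+ (+ 1) (+ Δ)) ⟨
    + n ℤ.- (+ 1 ℤ.+ + Δ)               ≡⟨ cong (λ x → + n ℤ.- x) (ℤP.pos-+ 1 Δ) ⟨
    + n ℤ.- + (1 + Δ)                   ∎)) (+≤+-∸ (subst (_≤ n) (rearrange k δ Δ) second))
    where
    open ≡-Reasoning
    rearrange : ∀ k δ Δ → suc k * δ + Δ + 1 ≡ δ * suc k + (1 + Δ)
    rearrange = solve-∀

no-odd-cycle-up-to : ∀ {n k} (G : Graph n) → (∀ j → 1 ≤ j → j ≤ k → ¬ ContainsCycle G (2 * j + 1)) →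
                     ∀ j → j ≤ k → ¬ ContainsCycle G (2 * j + 1)
no-odd-cycle-up-to G _ zero _ (c , _ , _ , loop) with () ← trans (≡.sym loop) (irrefl G (c Fin.zero))
no-odd-cycle-up-to G no-odd-cycle (suc j) = no-odd-cycle (suc j) (s≤s z≤n)

theorem1p4 : ∀ (k n : ℕ) → 2 ≤ k → (G : Graph n)
    → (∀ j → 1 ≤ j → j ≤ k → ¬ ContainsCycle G (2 * j + 1))
    → degBound n k (maxDeg G) < (+ minDeg G / 1)
    → Bipartite G
theorem1p4 k@(suc k-1) n 2≤k G no-short-odd-cycle bound =
  oddClosedWalkFree⇒bipartite G λ {l} → <-rec (NoOddClosedWalkOfLength G) shortest-impossible l
  where
  shortest-impossible : ∀ l → NoShorterOddClosedWalk G l → NoOddClosedWalkOfLength G l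
  shortest-impossible l shorter odd p with odd⇒2j+1 l odd
  ... | j , 2j+1≡l with j ≤? k
  ...   | yes j≤k = no-odd-cycle-up-to G no-short-odd-cycle j j≤k
                      (subst (ContainsCycle G) (≡.sym 2j+1≡l) (shortest-odd-closed-walk⇒cycle G shorter odd p))
  ...   | no j≰k with ℕP.m≤n⇒∃[o]m+o≡n (subst (7 ≤_) 2j+1≡l (7≤2j+1 2≤k (ℕP.≰⇒> j≰k)))
  ...     | m , refl = ℚP.<-irrefl refl (ℚP.<-≤-trans bound
              (uncurry (δ≤degBound n k-1 (maxDeg G) (minDeg G))
                (uncurry (long-cycle-arithmetic {δ = minDeg G} {maxDeg G} {n} (ℕP.≰⇒> j≰k) 2j+1≡l)
                  (LongShortestOdd.degree-bounds G odd shorter p))))
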